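{- Let $T$ be a tree and let $k$ be an integer with $2\le k\le \mathrm{diam}(T)$. Then $$\mu_k(T)=\max\{\mu(T_k)\,:\,T_k\in\mathcal{T}_k\},$$ where $\mathcal{T}_k$ is the set of all subtrees $T_k\subseteq T$ (subgraphs of $T$ that are trees) with diameter at most $k$.
   Context: For a graph $G$, a set $S\subseteq V(G)$ and an integer $k\ge 1$, two vertices $x,y$ are $S_k$-visible if there is a shortest $x,y$-path of length at most $k$ none of whose internal vertices lies in $S$. $S$ is a $k$-distance mutual-visibility set if every two vertices of $S$ are $S_k$-visible, and $\mu_k(G)$ is the maximum cardinality of such a set. Two vertices $x,y\in S$ are $S$-visible if there is a shortest $x,y$-path $P$ with $V(P)\cap S=\{x,y\}$; $S$ is a mutual-visibility set if every two vertices of $S$ are $S$-visible, and $\mu(G)$ is the maximum cardinality of a mutual-visibility set of $G$. -}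

module Defs where

open import Data.Nat using (ℕ; zero; suc; _≤_)
open import Data.Bool using (Bool; true; false; T)
open import Data.Fin using (Fin)
open import Data.List using (List; []; _∷_; length)
open import Data.List.Membership.Propositional using (_∈_; _∉_)
open import Data.List.Relation.Unary.All using (All)
open import Data.List.Relation.Unary.Unique.Propositional using (Unique)
open import Data.Product using (Σ; ∃; _×_; _,_)
open import Data.Empty using (⊥)
open import Relation.Binary.PropositionalEquality using (_≡_)

module _ {V : Set} (E : V → V → Set) where

  data Walk : V → V → Set where
    []  : ∀ {x} → Walk x x
    _∷_ : ∀ {x y z} → E x y → Walk y z → Walk x z

  len : ∀ {x y} → Walk x y → ℕ
  len []      = 0
  len (_ ∷ w) = suc (len w)

  vertices : ∀ {x y} → Walk x y → List V
  vertices {x} []      = x ∷ []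
  vertices {x} (_ ∷ w) = x ∷ vertices w

  internal : ∀ {x y} → Walk x y → List V
  internal []                       = []
  internal (_ ∷ [])                 = []
  internal (_∷_ {y = y} _ (e ∷ w))  = y ∷ internal (e ∷ w)

  IsShortest : ∀ {x y} → Walk x y → Set
  IsShortest {x} {y} p = ∀ (q : Walk x y) → len p ≤ len q

  Dist : V → V → ℕ → Set
  Dist x y d = Σ (Walk x y) λ p → IsShortest p × len p ≡ d

  DiamAtMost : ℕ → Set
  DiamAtMost D = ∀ x y d → Dist x y d → d ≤ D

  IsDiameter : ℕ → Set
  IsDiameter D = DiamAtMost D × Σ V λ x → Σ V λ y → Dist x y D

  Connected : Set
  Connected = ∀ x y → Walk x y

  IsPath : ∀ {x y} → Walk x y → Set
  IsPath w = Unique (vertices w)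

  -- no cycle: an edge x-y closed up by an y,x-path of length ≥ 2
  -- (i.e. a cycle of length ≥ 3)
  Acyclic : Set
  Acyclic = ∀ {x y} (e : E x y) (p : Walk y x) → IsPath p → 2 ≤ len p → ⊥

  IsTree : Set
  IsTree = V × Connected × Acyclic   -- nonempty, connected, acyclic

  VisibleK : List V → ℕ → V → V → Set
  VisibleK S k x y =
    Σ (Walk x y) λ p → IsShortest p × len p ≤ k × All (λ v → v ∉ S) (internal p)

  Visible : List V → V → V → Set
  Visible S x y =
    Σ (Walk x y) λ p → IsShortest p × All (λ v → v ∉ S) (internal p)

  -- sets of vertices are represented by duplicate-free lists
  IsKDistMVSet : ℕ → List V → Set
  IsKDistMVSet k S = Unique S × (∀ {x y} → x ∈ S → y ∈ S → VisibleK S k x y)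

  IsMVSet : List V → Set
  IsMVSet S = Unique S × (∀ {x y} → x ∈ S → y ∈ S → Visible S x y)

  IsMuK : ℕ → ℕ → Set
  IsMuK k m = (Σ (List V) λ S → IsKDistMVSet k S × length S ≡ m)
            × (∀ S → IsKDistMVSet k S → length S ≤ m)

  IsMu : ℕ → Set
  IsMu m = (Σ (List V) λ S → IsMVSet S × length S ≡ m)
         × (∀ S → IsMVSet S → length S ≤ m)

record SimpleGraph (n : ℕ) : Set where
  field
    adj     : Fin n → Fin n → Bool
    adj-sym : ∀ u v → adj u v ≡ adj v u
    irrefl  : ∀ v → adj v v ≡ false

open SimpleGraph public

Adj : ∀ {n} → SimpleGraph n → Fin n → Fin n → Set
Adj G u v = T (adj G u v)

record Subgraph {n : ℕ} (G : SimpleGraph n) : Set where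
  field
    inV    : Fin n → Bool
    inE    : Fin n → Fin n → Bool
    inE-sym : ∀ u v → inE u v ≡ inE v u
    inE⊆E  : ∀ u v → T (inE u v) → Adj G u v
    inE-ends : ∀ u v → T (inE u v) → T (inV u) × T (inV v)

open Subgraph public

SVert : ∀ {n} {G : SimpleGraph n} → Subgraph G → Set
SVert H = Σ (Fin _) λ v → T (inV H v)

SAdj : ∀ {n} {G : SimpleGraph n} (H : Subgraph G) → SVert H → SVert H → Set
SAdj H (u , _) (v , _) = T (inE H u v)

{-# OPTIONS --safe #-}
module Submission where

-- Paths in a forest are unique, so in T and in every subtree of T the shortest
-- paths are exactly the paths, and a shortest path of a subtree is a shortest
-- path of T.  Hence a mutual-visibility set of a subtree of diameter at most k
-- is a k-distance mutual-visibility set of T.  Conversely, let S be a maximum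
-- k-distance mutual-visibility set and let its hull be the union of the paths
-- of T between vertices of S.  The hull is convex, hence a subtree with the
-- distances of T; splitting paths at a vertex shows that two hull vertices are
-- no farther apart than some two vertices of S, so the hull has diameter at
-- most k; and the paths witnessing the visibility within S run inside the
-- hull, so S is a mutual-visibility set of the hull.

open import Defs
open import Data.Bool using (Bool; T; _∧_)
open import Data.Bool.Properties using (T-∧; T-irrelevant; ∧-comm)
open import Data.Empty using (⊥-elim)
open import Data.Fin using (Fin)
open import Data.Fin.Properties using () renaming (_≟_ to _≟ᶠ_)
open import Data.List using (List; []; _∷_; map; length)
open import Data.List.Properties using (length-map)
open import Data.List.Membership.Propositional using (_∈_; _∉_; find; lose)
open import Data.List.Membership.Propositional.Properties using (∈-map⁺; ∈-map⁻)
open import Data.List.Relation.Binary.Subset.Propositional using (_⊆_)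
open import Data.List.Relation.Unary.All as All using (All; []; _∷_)
import Data.List.Relation.Unary.All.Properties as All
open import Data.List.Relation.Unary.AllPairs using ([]; _∷_)
open import Data.List.Relation.Unary.Any using (Any; here; there; any?)
open import Data.List.Relation.Unary.Unique.Propositional using (Unique)
import Data.List.Relation.Unary.Unique.Propositional.Properties as Unique
open import Data.Nat using (ℕ; suc; _≤_; z≤n; s≤s)
open import Data.Nat.Properties
  using (≤-refl; ≤-trans; ≤-antisym; ≤-pred; m≤n⇒m≤1+n; <-irrefl; suc-injective; module ≤-Reasoning)
open import Data.Product using (Σ; ∃; ∃₂; _×_; _,_; proj₁; proj₂)
open import Data.Sum using (_⊎_; inj₁; inj₂)
open import Function using (_∘_)
open import Function.Bundles using (Equivalence)
open import Relation.Binary.Definitions using (DecidableEquality)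
open import Relation.Binary.PropositionalEquality
open import Relation.Nullary using (Dec; yes; no)
open import Relation.Nullary.Decidable using (⌊_⌋; toWitness; fromWitness; map′)

map-proj₁-toList : ∀ {A : Set} {P : A → Set} {xs : List A} (pxs : All P xs) →
                   map proj₁ (All.toList pxs) ≡ xs
map-proj₁-toList []        = refl
map-proj₁-toList (_ ∷ pxs) = cong (_ ∷_) (map-proj₁-toList pxs)

module _ {V : Set} {E : V → V → Set} where

  first∈vertices : ∀ {x y} (w : Walk E x y) → x ∈ vertices E w
  first∈vertices []      = here refl
  first∈vertices (_ ∷ _) = here refl

  last∈vertices : ∀ {x y} (w : Walk E x y) → y ∈ vertices E w
  last∈vertices []      = here refl
  last∈vertices (_ ∷ w) = there (last∈vertices w)

  length-vertices : ∀ {x y} (w : Walk E x y) → length (vertices E w) ≡ suc (len E w)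
  length-vertices []      = refl
  length-vertices (_ ∷ w) = cong suc (length-vertices w)

  ≢⇒1≤len : ∀ {x y} (w : Walk E x y) → x ≢ y → 1 ≤ len E w
  ≢⇒1≤len []      x≢x = ⊥-elim (x≢x refl)
  ≢⇒1≤len (_ ∷ _) _   = s≤s z≤n

  prefix : ∀ {x y u} (w : Walk E x y) → u ∈ vertices E w → Walk E x u
  prefix []      (here refl) = []
  prefix (_ ∷ _) (here refl) = []
  prefix (e ∷ w) (there u∈w) = e ∷ prefix w u∈w

  suffix : ∀ {x y u} (w : Walk E x y) → u ∈ vertices E w → Walk E u y
  suffix []      (here refl) = []
  suffix (e ∷ w) (here refl) = e ∷ w
  suffix (_ ∷ w) (there u∈w) = suffix w u∈w

  len-prefix≤ : ∀ {x y u} (w : Walk E x y) (u∈w : u ∈ vertices E w) → len E (prefix w u∈w) ≤ len E w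
  len-prefix≤ []      (here refl) = z≤n
  len-prefix≤ (_ ∷ _) (here refl) = z≤n
  len-prefix≤ (_ ∷ w) (there u∈w) = s≤s (len-prefix≤ w u∈w)

  len-suffix≤ : ∀ {x y u} (w : Walk E x y) (u∈w : u ∈ vertices E w) → len E (suffix w u∈w) ≤ len E w
  len-suffix≤ []      (here refl) = z≤n
  len-suffix≤ (_ ∷ _) (here refl) = ≤-refl
  len-suffix≤ (_ ∷ w) (there u∈w) = m≤n⇒m≤1+n (len-suffix≤ w u∈w)

  prefix⊆ : ∀ {x y u} (w : Walk E x y) (u∈w : u ∈ vertices E w) → vertices E (prefix w u∈w) ⊆ vertices E w
  prefix⊆ []      (here refl) v∈           = v∈
  prefix⊆ (_ ∷ _) (here refl) (here refl)  = here refl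
  prefix⊆ (_ ∷ _) (there _)   (here refl)  = here refl
  prefix⊆ (_ ∷ w) (there u∈w) (there v∈)   = there (prefix⊆ w u∈w v∈)

  suffix⊆ : ∀ {x y u} (w : Walk E x y) (u∈w : u ∈ vertices E w) → vertices E (suffix w u∈w) ⊆ vertices E w
  suffix⊆ []      (here refl) v∈ = v∈
  suffix⊆ (_ ∷ _) (here refl) v∈ = v∈
  suffix⊆ (_ ∷ w) (there u∈w) v∈ = there (suffix⊆ w u∈w v∈)

  suffix-isPath : ∀ {x y u} (w : Walk E x y) (u∈w : u ∈ vertices E w) → IsPath E w → IsPath E (suffix w u∈w)
  suffix-isPath []      (here refl) w-path       = w-path
  suffix-isPath (_ ∷ _) (here refl) w-path       = w-path
  suffix-isPath (_ ∷ w) (there u∈w) (_ ∷ w-path) = suffix-isPath w u∈w w-path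

  infixr 5 _++ᵂ_
  _++ᵂ_ : ∀ {x y z} → Walk E x y → Walk E y z → Walk E x z
  []      ++ᵂ q = q
  (e ∷ p) ++ᵂ q = e ∷ (p ++ᵂ q)

  ∈-vertices-++ᵂ : ∀ {x y z v} (p : Walk E x y) (q : Walk E y z) →
                   v ∈ vertices E (p ++ᵂ q) → v ∈ vertices E p ⊎ v ∈ vertices E q
  ∈-vertices-++ᵂ []      _ v∈          = inj₂ v∈
  ∈-vertices-++ᵂ (_ ∷ _) _ (here refl) = inj₁ (here refl)
  ∈-vertices-++ᵂ (_ ∷ p) q (there v∈) with ∈-vertices-++ᵂ p q v∈
  ... | inj₁ v∈p = inj₁ (there v∈p)
  ... | inj₂ v∈q = inj₂ v∈q

  infixl 5 _∷ʳ_
  _∷ʳ_ : ∀ {x y z} → Walk E x y → E y z → Walk E x z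
  []      ∷ʳ f = f ∷ []
  (e ∷ w) ∷ʳ f = e ∷ (w ∷ʳ f)

  len-∷ʳ : ∀ {x y z} (w : Walk E x y) (f : E y z) → len E (w ∷ʳ f) ≡ suc (len E w)
  len-∷ʳ []      _ = refl
  len-∷ʳ (_ ∷ w) f = cong suc (len-∷ʳ w f)

  ∈-vertices-∷ʳ : ∀ {x y z v} (w : Walk E x y) (f : E y z) →
                  v ∈ vertices E (w ∷ʳ f) → v ∈ vertices E w ⊎ v ≡ z
  ∈-vertices-∷ʳ []      _ (here refl)         = inj₁ (here refl)
  ∈-vertices-∷ʳ []      _ (there (here refl)) = inj₂ refl
  ∈-vertices-∷ʳ (_ ∷ _) _ (here refl)         = inj₁ (here refl)
  ∈-vertices-∷ʳ (_ ∷ w) f (there v∈) with ∈-vertices-∷ʳ w f v∈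
  ... | inj₁ v∈w = inj₁ (there v∈w)
  ... | inj₂ v≡z = inj₂ v≡z

  ∷ʳ-isPath : ∀ {x y z} (w : Walk E x y) (f : E y z) → IsPath E w → z ∉ vertices E w → IsPath E (w ∷ʳ f)
  ∷ʳ-isPath []      _ _               z∉w = ((λ x≡z → z∉w (here (sym x≡z))) ∷ []) ∷ [] ∷ []
  ∷ʳ-isPath (_ ∷ w) f (x∉w ∷ w-path) z∉w =
    All.tabulate x≢ ∷ ∷ʳ-isPath w f w-path (λ z∈w → z∉w (there z∈w))
    where
      x≢ : ∀ {v} → v ∈ vertices E (w ∷ʳ f) → _ ≢ v
      x≢ v∈ with ∈-vertices-∷ʳ w f v∈
      ... | inj₁ v∈w  = All.lookup x∉w v∈w
      ... | inj₂ refl = λ x≡z → z∉w (here (sym x≡z))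

module _ {V : Set} {E : V → V → Set} (_≟_ : DecidableEquality V) where
  open import Data.List.Membership.DecPropositional _≟_ using (_∈?_)

  record Shortcut {x y} (w : Walk E x y) : Set where
    field
      path      : Walk E x y
      isPath    : IsPath E path
      len≤      : len E path ≤ len E w
      vertices⊆ : vertices E path ⊆ vertices E w

  shortcut : ∀ {x y} (w : Walk E x y) → Shortcut w
  shortcut [] = record { path = [] ; isPath = [] ∷ [] ; len≤ = z≤n ; vertices⊆ = λ v∈ → v∈ }
  shortcut {x} (e ∷ w) = extend (x ∈? vertices E path)
    where
      open Shortcut (shortcut w)
      extend : Dec (x ∈ vertices E path) → Shortcut (e ∷ w)
      extend (yes x∈p) = record
        { path      = suffix path x∈p
        ; isPath    = suffix-isPath path x∈p isPath
        ; len≤      = ≤-trans (len-suffix≤ path x∈p) (m≤n⇒m≤1+n len≤)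
        ; vertices⊆ = λ v∈ → there (vertices⊆ (suffix⊆ path x∈p v∈))
        }
      extend (no x∉p) = record
        { path      = e ∷ path
        ; isPath    = All.¬Any⇒All¬ _ x∉p ∷ isPath
        ; len≤      = s≤s len≤
        ; vertices⊆ = λ { (here refl) → here refl ; (there v∈) → there (vertices⊆ v∈) }
        }

  shortest⇒isPath : ∀ {x y} (w : Walk E x y) → IsShortest E w → IsPath E w
  shortest⇒isPath []      _            = [] ∷ []
  shortest⇒isPath {x} (e ∷ w) e∷w-shortest with x ∈? vertices E w
  ... | yes x∈w = ⊥-elim (<-irrefl refl
          (≤-trans (e∷w-shortest (suffix w x∈w)) (len-suffix≤ w x∈w)))
  ... | no x∉w  = All.¬Any⇒All¬ _ x∉w ∷ shortest⇒isPath w (λ q → ≤-pred (e∷w-shortest (e ∷ q)))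

module _ {V : Set} {E : V → V → Set} (E-sym : ∀ {x y} → E x y → E y x) where

  reverse : ∀ {x y} → Walk E x y → Walk E y x
  reverse []      = []
  reverse (e ∷ w) = reverse w ∷ʳ E-sym e

  len-reverse : ∀ {x y} (w : Walk E x y) → len E (reverse w) ≡ len E w
  len-reverse []      = refl
  len-reverse (e ∷ w) = trans (len-∷ʳ (reverse w) (E-sym e)) (cong suc (len-reverse w))

  reverse⊆ : ∀ {x y} (w : Walk E x y) → vertices E (reverse w) ⊆ vertices E w
  reverse⊆ []      v∈ = v∈
  reverse⊆ (e ∷ w) v∈ with ∈-vertices-∷ʳ (reverse w) (E-sym e) v∈
  ... | inj₁ v∈w  = there (reverse⊆ w v∈w)
  ... | inj₂ refl = here refl

module Forest {V : Set} {E : V → V → Set} (_≟_ : DecidableEquality V)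
              (E-sym : ∀ {x y} → E x y → E y x) (acyclic : Acyclic E) where

  paths-unique : ∀ {x y} (p q : Walk E x y) → IsPath E p → IsPath E q → vertices E p ≡ vertices E q
  paths-unique []      []      _         _         = refl
  paths-unique []      (_ ∷ q) _         (x∉q ∷ _) = ⊥-elim (All.lookup x∉q (last∈vertices q) refl)
  paths-unique (_ ∷ p) []      (x∉p ∷ _) _         = ⊥-elim (All.lookup x∉p (last∈vertices p) refl)
  paths-unique {x} (_∷_ {y = a} e p) (_∷_ {y = b} f q) (x∉p ∷ p-path) (x∉q ∷ q-path) with a ≟ b
  ... | yes refl = cong (x ∷_) (paths-unique p q p-path q-path)
  ... | no a≢b   = ⊥-elim (acyclic e cycle cycle-isPath 2≤len)
    where
      -- p followed by q backwards joins a to b avoiding x; the edges b x a close it up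
      open Shortcut (shortcut _≟_ (p ++ᵂ reverse E-sym q))
      cycle : Walk E a x
      cycle = path ∷ʳ E-sym f
      x∉path : x ∉ vertices E path
      x∉path x∈ with ∈-vertices-++ᵂ p (reverse E-sym q) (vertices⊆ x∈)
      ... | inj₁ x∈p = All.lookup x∉p x∈p refl
      ... | inj₂ x∈q = All.lookup x∉q (reverse⊆ E-sym q x∈q) refl
      cycle-isPath : IsPath E cycle
      cycle-isPath = ∷ʳ-isPath path (E-sym f) isPath x∉path
      2≤len : 2 ≤ len E cycle
      2≤len rewrite len-∷ʳ path (E-sym f) = s≤s (≢⇒1≤len path a≢b)

  paths-same-len : ∀ {x y} (p q : Walk E x y) → IsPath E p → IsPath E q → len E p ≡ len E q
  paths-same-len p q p-path q-path = suc-injective (begin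
    suc (len E p)           ≡⟨ length-vertices p ⟨
    length (vertices E p)   ≡⟨ cong length (paths-unique p q p-path q-path) ⟩
    length (vertices E q)   ≡⟨ length-vertices q ⟩
    suc (len E q)           ∎)
    where open ≡-Reasoning

  isPath⇒shortest : ∀ {x y} (p : Walk E x y) → IsPath E p → IsShortest E p
  isPath⇒shortest p p-path q = subst (_≤ len E q) (paths-same-len path p isPath p-path) len≤
    where open Shortcut (shortcut _≟_ q)

module Tree {V : Set} {E : V → V → Set} (_≟_ : DecidableEquality V)
            (E-sym : ∀ {x y} → E x y → E y x) (acyclic : Acyclic E) (connected : Connected E) where
  open Forest _≟_ E-sym acyclic public
  open import Data.List.Membership.DecPropositional _≟_ using (_∈?_)

  geodesic : (x y : V) → Walk E x y
  geodesic x y = Shortcut.path (shortcut _≟_ (connected x y))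

  geodesic-isPath : ∀ x y → IsPath E (geodesic x y)
  geodesic-isPath x y = Shortcut.isPath (shortcut _≟_ (connected x y))

  interval : V → V → List V
  interval x y = vertices E (geodesic x y)

  dist : V → V → ℕ
  dist x y = len E (geodesic x y)

  dist≤len : ∀ {x y} (w : Walk E x y) → dist x y ≤ len E w
  dist≤len {x} {y} = isPath⇒shortest (geodesic x y) (geodesic-isPath x y)

  isPath⇒vertices≡interval : ∀ {x y} (p : Walk E x y) → IsPath E p → vertices E p ≡ interval x y
  isPath⇒vertices≡interval {x} {y} p p-path = paths-unique p (geodesic x y) p-path (geodesic-isPath x y)

  interval⊆ : ∀ {x y} (w : Walk E x y) → interval x y ⊆ vertices E w
  interval⊆ w v∈ = vertices⊆ (subst (_ ∈_) (sym (isPath⇒vertices≡interval path isPath)) v∈)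
    where open Shortcut (shortcut _≟_ w)

  dist-sym : ∀ x y → dist x y ≡ dist y x
  dist-sym x y = ≤-antisym (dist-reverse≤ x y) (dist-reverse≤ y x)
    where
      dist-reverse≤ : ∀ x y → dist x y ≤ dist y x
      dist-reverse≤ x y = subst (dist x y ≤_) (len-reverse E-sym (geodesic y x))
                                (dist≤len (reverse E-sym (geodesic y x)))

  interval-sym : ∀ {x y} → interval x y ⊆ interval y x
  interval-sym {x} {y} v∈ = reverse⊆ E-sym (geodesic y x) (interval⊆ (reverse E-sym (geodesic y x)) v∈)

  interval-split : ∀ {x y v} z → v ∈ interval x y → v ∈ interval x z ⊎ v ∈ interval z y
  interval-split {x} {y} z v∈ = ∈-vertices-++ᵂ (geodesic x z) (geodesic z y)
                                  (interval⊆ (geodesic x z ++ᵂ geodesic z y) v∈)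

  interval-⊆ : ∀ {x y u} → u ∈ interval x y → interval x u ⊆ interval x y
  interval-⊆ {x} {y} u∈ v∈ = prefix⊆ (geodesic x y) u∈ (interval⊆ (prefix (geodesic x y) u∈) v∈)

  dist-≤ˡ : ∀ {x y u} → u ∈ interval x y → dist x u ≤ dist x y
  dist-≤ˡ {x} {y} u∈ = ≤-trans (dist≤len (prefix (geodesic x y) u∈)) (len-prefix≤ (geodesic x y) u∈)

  dist-≤ʳ : ∀ {x y u} → u ∈ interval x y → dist u y ≤ dist x y
  dist-≤ʳ {x} {y} u∈ = ≤-trans (dist≤len (suffix (geodesic x y) u∈)) (len-suffix≤ (geodesic x y) u∈)

  InHull : List V → V → Set
  InHull S v = ∃₂ λ x y → x ∈ S × y ∈ S × v ∈ interval x y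

  InHull? : ∀ S v → Dec (InHull S v)
  InHull? S v = map′ fromAny toAny (any? (λ x → any? (λ y → v ∈? interval x y) S) S)
    where
      fromAny : Any (λ x → Any (λ y → v ∈ interval x y) S) S → InHull S v
      fromAny v∈ˣ with find v∈ˣ
      ... | x , x∈S , v∈ʸ with find v∈ʸ
      ...   | y , y∈S , v∈ = x , y , x∈S , y∈S , v∈
      toAny : InHull S v → Any (λ x → Any (λ y → v ∈ interval x y) S) S
      toAny (_ , _ , x∈S , y∈S , v∈) = lose x∈S (lose y∈S v∈)

  ∈⇒InHull : ∀ {S x} → x ∈ S → InHull S x
  ∈⇒InHull {x = x} x∈S = x , x , x∈S , x∈S , first∈vertices (geodesic x x)

  InHull-convex : ∀ {S u v w} → InHull S u → InHull S v → w ∈ interval u v → InHull S w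
  InHull-convex {w = w} (x₁ , y₁ , x₁∈S , y₁∈S , u∈) (x₂ , y₂ , x₂∈S , y₂∈S , v∈) w∈
    with interval-split x₁ w∈
  ... | inj₁ w∈ux₁ = x₁ , y₁ , x₁∈S , y₁∈S , interval-⊆ u∈ (interval-sym w∈ux₁)
  ... | inj₂ w∈x₁v with interval-split x₂ w∈x₁v
  ...   | inj₁ w∈x₁x₂ = x₁ , x₂ , x₁∈S , x₂∈S , w∈x₁x₂
  ...   | inj₂ w∈x₂v  = x₂ , y₂ , x₂∈S , y₂∈S , interval-⊆ v∈ w∈x₂v

  -- Split the geodesic carrying a hull vertex at the other vertex: each piece
  -- lies on a geodesic between vertices of S.
  module _ {S : List V} {k : ℕ} (S-close : ∀ {x y} → x ∈ S → y ∈ S → dist x y ≤ k) where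

    InHull-dist≤ˡ : ∀ {t v} → t ∈ S → InHull S v → dist t v ≤ k
    InHull-dist≤ˡ {t} {v} t∈S (x , y , x∈S , y∈S , v∈) with interval-split t v∈
    ... | inj₁ v∈xt = subst (_≤ k) (dist-sym v t) (≤-trans (dist-≤ʳ v∈xt) (S-close x∈S t∈S))
    ... | inj₂ v∈ty = ≤-trans (dist-≤ˡ v∈ty) (S-close t∈S y∈S)

    InHull-dist≤ : ∀ {u v} → InHull S u → InHull S v → dist u v ≤ k
    InHull-dist≤ {u} {v} (x , y , x∈S , y∈S , u∈) v-in with interval-split v u∈
    ... | inj₁ u∈xv = ≤-trans (dist-≤ʳ u∈xv) (InHull-dist≤ˡ x∈S v-in)
    ... | inj₂ u∈vy = subst (_≤ k) (dist-sym v u)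
                        (≤-trans (dist-≤ˡ u∈vy) (subst (_≤ k) (dist-sym y v) (InHull-dist≤ˡ y∈S v-in)))

module MapWalk {V U : Set} {E : V → V → Set} {F : U → U → Set}
               (f : V → U) (f-hom : ∀ {x y} → E x y → F (f x) (f y)) where

  mapWalk : ∀ {x y} → Walk E x y → Walk F (f x) (f y)
  mapWalk []      = []
  mapWalk (e ∷ w) = f-hom e ∷ mapWalk w

  len-mapWalk : ∀ {x y} (w : Walk E x y) → len F (mapWalk w) ≡ len E w
  len-mapWalk []      = refl
  len-mapWalk (_ ∷ w) = cong suc (len-mapWalk w)

  vertices-mapWalk : ∀ {x y} (w : Walk E x y) → vertices F (mapWalk w) ≡ map f (vertices E w)
  vertices-mapWalk []      = refl
  vertices-mapWalk (_ ∷ w) = cong (f _ ∷_) (vertices-mapWalk w)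

  internal-mapWalk : ∀ {x y} (w : Walk E x y) → internal F (mapWalk w) ≡ map f (internal E w)
  internal-mapWalk []            = refl
  internal-mapWalk (_ ∷ [])      = refl
  internal-mapWalk (_ ∷ (e ∷ w)) = cong (f _ ∷_) (internal-mapWalk (e ∷ w))

module _ {n : ℕ} {G : SimpleGraph n} (H : Subgraph G) where

  SVert-≡ : {a b : SVert H} → proj₁ a ≡ proj₁ b → a ≡ b
  SVert-≡ {_ , p} {_ , q} refl = cong (_ ,_) (T-irrelevant p q)

  _≟ˢ_ : DecidableEquality (SVert H)
  a ≟ˢ b = map′ SVert-≡ (cong proj₁) (proj₁ a ≟ᶠ proj₁ b)

  SAdj⇒Adj : ∀ {a b} → SAdj H a b → Adj G (proj₁ a) (proj₁ b)
  SAdj⇒Adj {a} {b} = inE⊆E H (proj₁ a) (proj₁ b)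

  open MapWalk proj₁ (λ {a} {b} → SAdj⇒Adj {a} {b}) public
    renaming (mapWalk to embedWalk; len-mapWalk to len-embedWalk;
              vertices-mapWalk to vertices-embedWalk; internal-mapWalk to internal-embedWalk)

  embedWalk-isPath : ∀ {a b} (p : Walk (SAdj H) a b) → IsPath (SAdj H) p → IsPath (Adj G) (embedWalk p)
  embedWalk-isPath p p-path = subst Unique (sym (vertices-embedWalk p)) (Unique.map⁺ SVert-≡ p-path)

  subgraph-acyclic : Acyclic (Adj G) → Acyclic (SAdj H)
  subgraph-acyclic acyclic {a} {b} e p p-path 2≤len =
    acyclic (SAdj⇒Adj {a} {b} e) (embedWalk p) (embedWalk-isPath p p-path)
            (subst (2 ≤_) (sym (len-embedWalk p)) 2≤len)

module _ {n : ℕ} (G : SimpleGraph n) (C : Fin n → Bool) where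

  induced : Subgraph G
  induced = record
    { inV      = C
    ; inE      = λ u v → adj G u v ∧ (C u ∧ C v)
    ; inE-sym  = λ u v → cong₂ _∧_ (adj-sym G u v) (∧-comm (C u) (C v))
    ; inE⊆E    = λ u v uv → proj₁ (Equivalence.to T-∧ uv)
    ; inE-ends = λ u v uv → Equivalence.to T-∧ (proj₂ (Equivalence.to (T-∧ {adj G u v}) uv))
    }

  induced-adj : ∀ {u v} → Adj G u v → (cu : T (C u)) (cv : T (C v)) → SAdj induced (u , cu) (v , cv)
  induced-adj uv cu cv = Equivalence.from T-∧ (uv , Equivalence.from T-∧ (cu , cv))

  liftWalk : ∀ {u v} (p : Walk (Adj G) u v) {cu : T (C u)} {cv : T (C v)} →
             (∀ {w} → w ∈ vertices (Adj G) p → T (C w)) → Walk (SAdj induced) (u , cu) (v , cv)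
  liftWalk {u} [] {cu} {cv} _ = subst (λ c → Walk (SAdj induced) (u , cu) (u , c)) (T-irrelevant cu cv) []
  liftWalk (_∷_ {y = w} e p) {cu} inC = induced-adj e cu cw ∷ liftWalk p {cw} (λ w∈ → inC (there w∈))
    where
      cw : T (C w)
      cw = inC (there (first∈vertices p))

  embedWalk-liftWalk : ∀ {u v} (p : Walk (Adj G) u v) {cu : T (C u)} {cv : T (C v)}
                       (inC : ∀ {w} → w ∈ vertices (Adj G) p → T (C w)) →
                       embedWalk induced (liftWalk p {cu} {cv} inC) ≡ p
  embedWalk-liftWalk [] {cu} {cv} _ with T-irrelevant cu cv
  ... | refl = refl
  embedWalk-liftWalk (e ∷ p) inC =
    cong₂ _∷_ (T-irrelevant _ e)
              (embedWalk-liftWalk p {inC (there (first∈vertices p))} (λ w∈ → inC (there w∈)))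

  len-liftWalk : ∀ {u v} (p : Walk (Adj G) u v) {cu : T (C u)} {cv : T (C v)}
                 (inC : ∀ {w} → w ∈ vertices (Adj G) p → T (C w)) →
                 len (SAdj induced) (liftWalk p {cu} {cv} inC) ≡ len (Adj G) p
  len-liftWalk p inC =
    trans (sym (len-embedWalk induced (liftWalk p inC))) (cong (len (Adj G)) (embedWalk-liftWalk p inC))

  internal-liftWalk : ∀ {u v} (p : Walk (Adj G) u v) {cu : T (C u)} {cv : T (C v)}
                      (inC : ∀ {w} → w ∈ vertices (Adj G) p → T (C w)) →
                      map proj₁ (internal (SAdj induced) (liftWalk p {cu} {cv} inC)) ≡ internal (Adj G) p
  internal-liftWalk p inC =
    trans (sym (internal-embedWalk induced (liftWalk p inC))) (cong (internal (Adj G)) (embedWalk-liftWalk p inC))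

  liftWalk-shortest : ∀ {u v} (p : Walk (Adj G) u v) {cu : T (C u)} {cv : T (C v)}
                      (inC : ∀ {w} → w ∈ vertices (Adj G) p → T (C w)) →
                      IsShortest (Adj G) p → IsShortest (SAdj induced) (liftWalk p {cu} {cv} inC)
  liftWalk-shortest p inC p-shortest r = begin
    len (SAdj induced) (liftWalk p inC)  ≡⟨ len-liftWalk p inC ⟩
    len (Adj G) p                        ≤⟨ p-shortest (embedWalk induced r) ⟩
    len (Adj G) (embedWalk induced r)    ≡⟨ len-embedWalk induced r ⟩
    len (SAdj induced) r                 ∎
    where open ≤-Reasoning

module _ {V : Set} {E : V → V → Set} where

  singleton-isKDistMVSet : ∀ k (v : V) → IsKDistMVSet E k (v ∷ [])
  singleton-isKDistMVSet k v = [] ∷ [] , λ { (here refl) (here refl) → [] , (λ _ → z≤n) , z≤n , [] }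

  maximum-kDistMVSet-nonempty : ∀ {k} → V → (S : List V) →
    (∀ S' → IsKDistMVSet E k S' → length S' ≤ length S) → ∃ (_∈ S)
  maximum-kDistMVSet-nonempty {k} v [] maximum with maximum _ (singleton-isKDistMVSet k v)
  ... | ()
  maximum-kDistMVSet-nonempty _ (s ∷ _) _ = s , here refl

module TreeGraph {n : ℕ} (G : SimpleGraph n) (tree : IsTree (Adj G)) where

  Adj-sym : ∀ {u v} → Adj G u v → Adj G v u
  Adj-sym {u} {v} = subst T (adj-sym G u v)

  open Tree _≟ᶠ_ Adj-sym (proj₂ (proj₂ tree)) (proj₁ (proj₂ tree)) public

  embedWalk-shortest : (H : Subgraph G) {a b : SVert H} (p : Walk (SAdj H) a b) →
                       IsShortest (SAdj H) p → IsShortest (Adj G) (embedWalk H p)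
  embedWalk-shortest H p p-shortest =
    isPath⇒shortest (embedWalk H p) (embedWalk-isPath H p (shortest⇒isPath (_≟ˢ_ H) p p-shortest))

  mvSet⇒kDistMVSet : ∀ {k} (H : Subgraph G) → DiamAtMost (SAdj H) k →
                     ∀ {S} → IsMVSet (SAdj H) S → IsKDistMVSet (Adj G) k (map proj₁ S)
  mvSet⇒kDistMVSet {k} H diam {S} (S-unique , S-visible) = Unique.map⁺ (SVert-≡ H) S-unique , visible
    where
      ∉-proj₁ : ∀ {c} → c ∉ S → proj₁ c ∉ map proj₁ S
      ∉-proj₁ c∉S c∈ with ∈-map⁻ proj₁ c∈
      ... | c' , c'∈S , c≡c' = c∉S (subst (_∈ S) (sym (SVert-≡ H c≡c')) c'∈S)

      visible : ∀ {x y} → x ∈ map proj₁ S → y ∈ map proj₁ S → VisibleK (Adj G) (map proj₁ S) k x y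
      visible x∈ y∈ with ∈-map⁻ proj₁ x∈ | ∈-map⁻ proj₁ y∈
      ... | a , a∈S , refl | b , b∈S , refl with S-visible a∈S b∈S
      ...   | p , p-shortest , internal∉S =
        embedWalk H p ,
        embedWalk-shortest H p p-shortest ,
        subst (_≤ k) (sym (len-embedWalk H p)) (diam a b (len (SAdj H) p) (p , p-shortest , refl)) ,
        subst (All (_∉ map proj₁ S)) (sym (internal-embedWalk H p)) (All.map⁺ (All.map ∉-proj₁ internal∉S))

  kDistMVSet⇒dist≤ : ∀ {k S x y} → IsKDistMVSet (Adj G) k S → x ∈ S → y ∈ S → dist x y ≤ k
  kDistMVSet⇒dist≤ (_ , S-visible) x∈S y∈S with S-visible x∈S y∈S
  ... | p , _ , p≤k , _ = ≤-trans (dist≤len p) p≤k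

  module Hull (S : List (Fin n)) where

    inHull : Fin n → Bool
    inHull v = ⌊ InHull? S v ⌋

    hull : Subgraph G
    hull = induced G inHull

    geodesic⊆hull : ∀ {u v} → T (inHull u) → T (inHull v) → ∀ {w} → w ∈ interval u v → T (inHull w)
    geodesic⊆hull cu cv w∈ = fromWitness (InHull-convex (toWitness cu) (toWitness cv) w∈)

    hullGeodesic : (a b : SVert hull) → Walk (SAdj hull) a b
    hullGeodesic (u , cu) (v , cv) = liftWalk G inHull (geodesic u v) (geodesic⊆hull cu cv)

    hull-isTree : ∃ (_∈ S) → IsTree (SAdj hull)
    hull-isTree (s , s∈S) =
      (s , fromWitness (∈⇒InHull s∈S)) , hullGeodesic , subgraph-acyclic hull (proj₂ (proj₂ tree))

    hull-diam : ∀ {k} → (∀ {x y} → x ∈ S → y ∈ S → dist x y ≤ k) → DiamAtMost (SAdj hull) k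
    hull-diam {k} S-close a@(u , cu) b@(v , cv) _ (p , p-shortest , refl) = begin
      len (SAdj hull) p                   ≤⟨ p-shortest (hullGeodesic a b) ⟩
      len (SAdj hull) (hullGeodesic a b)  ≡⟨ len-liftWalk G inHull (geodesic u v) (geodesic⊆hull cu cv) ⟩
      dist u v                            ≤⟨ InHull-dist≤ S-close (toWitness cu) (toWitness cv) ⟩
      k                                   ∎
      where open ≤-Reasoning

    S⊆hull : All (T ∘ inHull) S
    S⊆hull = All.tabulate (λ x∈S → fromWitness (∈⇒InHull x∈S))

    hullS : List (SVert hull)
    hullS = All.toList S⊆hull

    map-proj₁-hullS : map proj₁ hullS ≡ S
    map-proj₁-hullS = map-proj₁-toList S⊆hull

    length-hullS : length hullS ≡ length S
    length-hullS = trans (sym (length-map proj₁ hullS)) (cong length map-proj₁-hullS)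

    ∈hullS⇒∈S : ∀ {a} → a ∈ hullS → proj₁ a ∈ S
    ∈hullS⇒∈S a∈ = subst (_ ∈_) map-proj₁-hullS (∈-map⁺ proj₁ a∈)

    kDistMVSet⇒hullS-mvSet : ∀ {k} → IsKDistMVSet (Adj G) k S → IsMVSet (SAdj hull) hullS
    kDistMVSet⇒hullS-mvSet (S-unique , S-visible) =
      Unique.map⁻ (subst Unique (sym map-proj₁-hullS) S-unique) , visible
      where
        visible : ∀ {a b} → a ∈ hullS → b ∈ hullS → Visible (SAdj hull) hullS a b
        visible {a} {b} a∈ b∈ with S-visible (∈hullS⇒∈S a∈) (∈hullS⇒∈S b∈)
        ... | p , p-shortest , _ , internal∉S =
          liftWalk G inHull p p⊆hull , liftWalk-shortest G inHull p p⊆hull p-shortest , internal∉hullS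
          where
            p⊆hull : ∀ {w} → w ∈ vertices (Adj G) p → T (inHull w)
            p⊆hull w∈ = fromWitness (_ , _ , ∈hullS⇒∈S a∈ , ∈hullS⇒∈S b∈ ,
              subst (_ ∈_) (isPath⇒vertices≡interval p (shortest⇒isPath _≟ᶠ_ p p-shortest)) w∈)
            internal∉hullS : All (_∉ hullS) (internal (SAdj hull) (liftWalk G inHull p p⊆hull))
            internal∉hullS = All.map (λ c∉S c∈ → c∉S (∈hullS⇒∈S c∈))
              (All.map⁻ (subst (All (_∉ S)) (sym (internal-liftWalk G inHull p p⊆hull)) internal∉S))

proposition4p3 : ∀ {n} (G : SimpleGraph n) → IsTree (Adj G) →
    ∀ (D k : ℕ) → IsDiameter (Adj G) D → 2 ≤ k → k ≤ D →
    ∀ (m : ℕ) → IsMuK (Adj G) k m →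
      ((H : Subgraph G) → IsTree (SAdj H) → DiamAtMost (SAdj H) k →
         ∀ m' → IsMu (SAdj H) m' → m' ≤ m)
      × Σ (Subgraph G) (λ H → IsTree (SAdj H) × DiamAtMost (SAdj H) k × IsMu (SAdj H) m)
proposition4p3 G tree _ k _ _ _ _ ((S , S-kDistMV , refl) , maximum) =
  subtree-bound ,
  hull , hull-isTree (maximum-kDistMVSet-nonempty (proj₁ tree) S maximum) , hull-diam S-close ,
  (hullS , kDistMVSet⇒hullS-mvSet S-kDistMV , length-hullS) , mvSet-bound hull (hull-diam S-close)
  where
    open TreeGraph G tree
    open Hull S

    S-close : ∀ {x y} → x ∈ S → y ∈ S → dist x y ≤ k
    S-close = kDistMVSet⇒dist≤ S-kDistMV

    mvSet-bound : (H : Subgraph G) → DiamAtMost (SAdj H) k →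
                  ∀ S' → IsMVSet (SAdj H) S' → length S' ≤ length S
    mvSet-bound H diam S' S'-mv =
      subst (_≤ length S) (length-map proj₁ S') (maximum _ (mvSet⇒kDistMVSet H diam S'-mv))

    subtree-bound : (H : Subgraph G) → IsTree (SAdj H) → DiamAtMost (SAdj H) k →
                    ∀ m' → IsMu (SAdj H) m' → m' ≤ length S
    subtree-bound H _ diam _ ((S' , S'-mv , refl) , _) = mvSet-bound H diam S' S'-mv
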